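{- Let $\alpha$ be a primitive element of $\mathbb{F}_{2^n}$, and identify $\mathbb{F}_2^n$ with $\mathbb{F}_{2^n}$ via a fixed $\mathbb{F}_2$-linear isomorphism. For $0 \le j \le 2^n-2$ let $\Phi_j$ map $\alpha^i \mapsto \alpha^{i+j}$ (exponents modulo $2^n-1$) and $0 \mapsto 0$, applied to subsets elementwise. Let $X = \{0, \alpha^{i_1}, \ldots, \alpha^{i_7}\}$ be a $3$-dimensional subspace of $\mathbb{F}_2^n$ with difference set $\Delta(X) = \{ i_r - i_s \bmod (2^n-1) : 1 \le r, s \le 7,\ r \ne s\}$ satisfying $|\Delta(X)| = 42$. Then the cyclic shifts $\Phi_j(X)$, $0 \le j \le 2^n-2$, are $2^n-1$ distinct $3$-dimensional subspaces, and the $7(2^n-1)$ two-dimensional subspaces contained in these $2^n-1$ subspaces are all distinct.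
   Context: The exponents $i_1,\dots,i_7$ are taken in $\mathbb{Z}_{2^n-1}$. -}

module Defs where

open import Level using (Level; _⊔_)
open import Algebra.Bundles using (CommutativeRing; Semiring)
open import Data.Nat using (ℕ; _∸_; _<_) renaming (_+_ to _+ℕ_; _^_ to _^ℕ_)
open import Data.Fin using (Fin; toℕ)
open import Data.Integer using (ℤ; +_) renaming (_-_ to _-ℤ_)
open import Data.Integer.Divisibility using () renaming (_∣_ to _∣ℤ_)
open import Data.Product using (Σ; ∃; _×_; _,_)
open import Data.Sum using (_⊎_)
open import Relation.Binary.PropositionalEquality using (_≡_; _≢_)
open import Relation.Nullary using (¬_)
import Algebra.Definitions.RawSemiring as RawSemiringDefs

ord : ℕ → ℕ
ord n = 2 ^ℕ n ∸ 1

module FieldDefs {c ℓ : Level} (R : CommutativeRing c ℓ) where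
  open CommutativeRing R
  open RawSemiringDefs (Semiring.rawSemiring semiring) using () renaming (_^_ to _^R_)

  -- F is a field of characteristic 2 with primitive element α of order 2^n - 1
  -- whose powers (together with 0) exhaust F; i.e. F ≅ F_{2^n}, α primitive.
  IsPrimitiveOfGF2 : ℕ → Carrier → Set (c ⊔ ℓ)
  IsPrimitiveOfGF2 n α =
    (¬ (1# ≈ 0#)) ×
    (1# + 1# ≈ 0#) ×
    (α ^R ord n ≈ 1#) ×
    (∀ (k : ℕ) → 0 < k → k < ord n → ¬ (α ^R k ≈ 1#)) ×
    (∀ (x : Carrier) → x ≈ 0# ⊎ ∃ λ (k : ℕ) → x ≈ α ^R k)

  Subset : Set (c ⊔ Level.suc ℓ)
  Subset = Carrier → Set ℓ

  _≐_ : Subset → Subset → Set (c ⊔ ℓ)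
  A ≐ B = ∀ x → (A x → B x) × (B x → A x)

  shiftSet : Carrier → {N : ℕ} → (Fin 7 → Fin N) → ℕ → Subset
  shiftSet α i j x = x ≈ 0# ⊎ ∃ λ (r : Fin 7) → x ≈ α ^R (toℕ (i r) +ℕ j)

  -- {0, α^{e_1}, ..., α^{e_7}} (given by exponents e) is a 3-dimensional
  -- F_2-subspace: its 8 elements are distinct and it is closed under addition.
  Is3DimSubspace : Carrier → (Fin 7 → ℕ) → Set ℓ
  Is3DimSubspace α e =
    (∀ (r : Fin 7) → ¬ (α ^R e r ≈ 0#)) ×
    (∀ (r s : Fin 7) → r ≢ s → ¬ (α ^R e r ≈ α ^R e s)) ×
    (∀ (r s : Fin 7) → r ≢ s → ∃ λ (t : Fin 7) → α ^R e r + α ^R e s ≈ α ^R e t)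

  span2 : Carrier → Carrier → Subset
  span2 a b x = x ≈ 0# ⊎ x ≈ a ⊎ x ≈ b ⊎ x ≈ a + b

  -- a, b are linearly independent over F_2 (distinct and nonzero)
  Indep2 : Carrier → Carrier → Set ℓ
  Indep2 a b = (¬ (a ≈ 0#)) × (¬ (b ≈ 0#)) × (¬ (a ≈ b))

SameDiff : (N a b a' b' : ℕ) → Set
SameDiff N a b a' b' = (+ N) ∣ℤ (((+ a) -ℤ (+ b)) -ℤ ((+ a') -ℤ (+ b')))

-- |Δ(X)| = 42: the 42 differences i_r - i_s (r ≠ s) are pairwise distinct mod N
DiffSetSize42 : {N : ℕ} → (Fin 7 → Fin N) → Set
DiffSetSize42 {N} i =
  ∀ (r s r' s' : Fin 7) → r ≢ s → r' ≢ s' →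
    SameDiff N (toℕ (i r)) (toℕ (i s)) (toℕ (i r')) (toℕ (i s')) →
    (r ≡ r') × (s ≡ s')

module Submission where

-- Write X = {0, α^{e_1}, …, α^{e_7}} with e_r = toℕ (i r), and N = 2^n - 1 for
-- the multiplicative order of α, so that Φ_j(X) = {0, α^{e_1+j}, …, α^{e_7+j}}.
--
-- (1) Multiplication by the unit α^j is additive and injective, so it carries
--     the subspace X onto a subspace; this is `shift-subspace`.
-- (2,3) The key fact is `common-pair⇒same-shift`: if two shifts Φ_j(X) and
--     Φ_{j'}(X) share two independent points a, b, then j = j'.  Indeed, from
--     a = α^{e_r+j} = α^{e_p+j'} and b = α^{e_s+j} = α^{e_q+j'} the exponents
--     agree modulo N, hence e_r - e_s ≡ e_p - e_q (mod N); as the 42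
--     differences are distinct, r = p, and then j ≡ j' (mod N), so j = j'.
--     Distinct shifts are different since Φ_j(X) contains two independent
--     points, and a plane {0,a,b,a+b} inside Φ_j(X) ∩ Φ_{j'}(X) gives a common
--     independent pair.

open import Defs
open import Level using (Level)
open import Algebra.Bundles using (CommutativeRing)
open import Data.Nat using (ℕ; _+_)
open import Data.Fin using (Fin; toℕ)
open import Data.Product using (_×_)
open import Relation.Binary.PropositionalEquality using (_≡_; _≢_)
open import Relation.Nullary using (¬_)

open import Data.Nat as ℕ using (zero; suc; _<_; NonZero)
open import Data.Nat.Properties as ℕP using (∣m-n∣≡0⇒m≡n; ∣m-n∣≤m⊔n; ⊔-pres-<m; ≤-<-trans)
open import Data.Nat.DivMod using (_%_; _/_; m<n⇒m%n≡m; m≡m%n+[m/n]*n; m%n<n)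
open import Data.Nat.Divisibility using (_∣_; n∣m⇒m%n≡0; m%n≡0⇒n∣m)
open import Data.Integer as ℤ using (+_; _⊖_) renaming (_-_ to _-ℤ_)
open import Data.Integer.Properties using ([+m]-[+n]≡m⊖n; [1+m]⊖[1+n]≡m⊖n)
open import Data.Integer.Divisibility.Signed as Signed using (∣m∣n⇒∣m-n; ∣⇒∣ᵤ; ∣ᵤ⇒∣)
open import Data.Integer.Solver using (module +-*-Solver)
open import Data.Fin using () renaming (zero to 0F; suc to sucF)
open import Data.Fin.Properties using (toℕ-injective; toℕ<n)
open import Data.Product using (_,_; ∃; proj₁)
open import Data.Sum using (inj₁; inj₂)
open import Data.Empty using (⊥-elim)
import Relation.Binary.PropositionalEquality as ≡

infix 4 _≡[mod_]_
_≡[mod_]_ : ℕ → ℕ → ℕ → Set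
a ≡[mod N ] b = (+ N) Signed.∣ (+ a -ℤ + b)

∣m⊖n∣≡∣m-n∣ : ∀ m n → ℤ.∣ m ⊖ n ∣ ≡ ℕ.∣ m - n ∣
∣m⊖n∣≡∣m-n∣ zero    zero    = ≡.refl
∣m⊖n∣≡∣m-n∣ zero    (suc n) = ≡.refl
∣m⊖n∣≡∣m-n∣ (suc m) zero    = ≡.refl
∣m⊖n∣≡∣m-n∣ (suc m) (suc n) = ≡.trans (≡.cong ℤ.∣_∣ ([1+m]⊖[1+n]≡m⊖n m n)) (∣m⊖n∣≡∣m-n∣ m n)

multiple<⇒≡0 : ∀ {N d} .{{_ : NonZero N}} → d < N → N ∣ d → d ≡ 0
multiple<⇒≡0 {N} {d} d<N N∣d = ≡.trans (≡.sym (m<n⇒m%n≡m d<N)) (n∣m⇒m%n≡0 d N N∣d)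

residue-injective : ∀ {N} (j j' : Fin N) → toℕ j ≡[mod N ] toℕ j' → j ≡ j'
residue-injective {N} j j' j≡j' = toℕ-injective (∣m-n∣≡0⇒m≡n (multiple<⇒≡0 distance<N N∣distance))
  where
  instance
    N≢0 : NonZero N
    N≢0 = ℕ.>-nonZero (≤-<-trans ℕ.z≤n (toℕ<n j))
  distance<N : ℕ.∣ toℕ j - toℕ j' ∣ < N
  distance<N = ≤-<-trans (∣m-n∣≤m⊔n (toℕ j) (toℕ j')) (⊔-pres-<m (toℕ<n j) (toℕ<n j'))
  N∣distance : N ∣ ℕ.∣ toℕ j - toℕ j' ∣
  N∣distance = ≡.subst (N ∣_)
    (≡.trans (≡.cong ℤ.∣_∣ ([+m]-[+n]≡m⊖n (toℕ j) (toℕ j'))) (∣m⊖n∣≡∣m-n∣ (toℕ j) (toℕ j')))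
    (∣⇒∣ᵤ j≡j')

multiples-congruent : ∀ {N} x y → N ∣ x → N ∣ y → x ≡[mod N ] y
multiples-congruent {N} x y N∣x N∣y = ∣m∣n⇒∣m-n (∣ᵤ⇒∣ {+ N} {+ x} N∣x) (∣ᵤ⇒∣ {+ N} {+ y} N∣y)

+-cancelˡ-≡[mod] : ∀ {N} a {j k} → a + j ≡[mod N ] a + k → j ≡[mod N ] k
+-cancelˡ-≡[mod] {N} a {j} {k} = ≡.subst ((+ N) Signed.∣_) (difference (+ a) (+ j) (+ k))
  where
  open +-*-Solver
  difference : ∀ a j k → (a ℤ.+ j) -ℤ (a ℤ.+ k) ≡ j -ℤ k
  difference = solve 3 (λ a j k → (a :+ j) :- (a :+ k) := j :- k) ≡.refl

shifted-pairs⇒SameDiff : ∀ {N} a b p q {j k} →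
  a + j ≡[mod N ] p + k → b + j ≡[mod N ] q + k → SameDiff N a b p q
shifted-pairs⇒SameDiff {N} a b p q {j} {k} a∼p b∼q =
  ∣⇒∣ᵤ (≡.subst ((+ N) Signed.∣_) (regroup (+ a) (+ b) (+ p) (+ q) (+ j) (+ k)) (∣m∣n⇒∣m-n a∼p b∼q))
  where
  open +-*-Solver
  regroup : ∀ a b p q j k →
    ((a ℤ.+ j) -ℤ (p ℤ.+ k)) -ℤ ((b ℤ.+ j) -ℤ (q ℤ.+ k)) ≡ (a -ℤ b) -ℤ (p -ℤ q)
  regroup = solve 6 (λ a b p q j k →
    ((a :+ j) :- (p :+ k)) :- ((b :+ j) :- (q :+ k)) := (a :- b) :- (p :- q)) ≡.refl

module _ {c ℓ : Level} (R : CommutativeRing c ℓ) where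
  open CommutativeRing R renaming (_+_ to _+R_)
  open FieldDefs R
  open import Algebra.Properties.Semiring.Exp semiring using (_^_; ^-congˡ; ^-congʳ; ^-homo-*; ^-assocʳ)
  open import Relation.Binary.Reasoning.Setoid setoid

  1^k≈1 : ∀ k → 1# ^ k ≈ 1#
  1^k≈1 zero    = refl
  1^k≈1 (suc k) = trans (*-identityˡ _) (1^k≈1 k)

  module Powers (α : Carrier) (N : ℕ) {{_ : NonZero N}} (α^N≈1 : α ^ N ≈ 1#) where

    α^[N*k]≈1 : ∀ k → α ^ (N ℕ.* k) ≈ 1#
    α^[N*k]≈1 k = begin
      α ^ (N ℕ.* k) ≈⟨ ^-assocʳ α N k ⟨
      (α ^ N) ^ k   ≈⟨ ^-congˡ k α^N≈1 ⟩
      1# ^ k        ≈⟨ 1^k≈1 k ⟩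
      1#            ∎

    -- α^k · α^{(N-1)k} = α^{Nk} ≈ 1, so α^{(N-1)k} inverts α^k.
    α^k-inverse : ∀ k → α ^ (k + ℕ.pred N ℕ.* k) ≈ 1#
    α^k-inverse k = trans (^-congʳ α (≡.cong (ℕ._* k) (ℕP.suc-pred N))) (α^[N*k]≈1 k)

    -- Powers of α can be cancelled, since they are units.
    *-cancelʳ-α^ : ∀ k {x y} → x * α ^ k ≈ y * α ^ k → x ≈ y
    *-cancelʳ-α^ k {x} {y} xα≈yα = begin
      x                 ≈⟨ *-identityʳ x ⟨
      x * 1#            ≈⟨ *-congˡ inverse≈1 ⟨
      x * (α ^ k * u)   ≈⟨ *-assoc x _ u ⟨
      (x * α ^ k) * u   ≈⟨ *-congʳ xα≈yα ⟩
      (y * α ^ k) * u   ≈⟨ *-assoc y _ u ⟩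
      y * (α ^ k * u)   ≈⟨ *-congˡ inverse≈1 ⟩
      y * 1#            ≈⟨ *-identityʳ y ⟩
      y                 ∎
      where
      u = α ^ (ℕ.pred N ℕ.* k)
      inverse≈1 : α ^ k * u ≈ 1#
      inverse≈1 = trans (sym (^-homo-* α k _)) (α^k-inverse k)

    shift-subspace : ∀ (e : Fin 7 → ℕ) j → Is3DimSubspace α e → Is3DimSubspace α (λ r → e r + j)
    shift-subspace e j (nonzero , distinct , closed) = nonzero′ , distinct′ , closed′
      where
      split : ∀ r → α ^ (e r + j) ≈ α ^ e r * α ^ j
      split r = ^-homo-* α (e r) j
      nonzero′ : ∀ r → ¬ (α ^ (e r + j) ≈ 0#)
      nonzero′ r ≈0 = nonzero r (*-cancelʳ-α^ j (trans (sym (split r)) (trans ≈0 (sym (zeroˡ _)))))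
      distinct′ : ∀ r s → r ≢ s → ¬ (α ^ (e r + j) ≈ α ^ (e s + j))
      distinct′ r s r≢s eq = distinct r s r≢s (*-cancelʳ-α^ j (trans (sym (split r)) (trans eq (split s))))
      closed′ : ∀ r s → r ≢ s → ∃ λ t → α ^ (e r + j) +R α ^ (e s + j) ≈ α ^ (e t + j)
      closed′ r s r≢s = let (t , sum≈) = closed r s r≢s in t , (begin
        α ^ (e r + j) +R α ^ (e s + j)     ≈⟨ +-cong (split r) (split s) ⟩
        α ^ e r * α ^ j +R α ^ e s * α ^ j ≈⟨ distribʳ _ _ _ ⟨
        (α ^ e r +R α ^ e s) * α ^ j       ≈⟨ *-congʳ sum≈ ⟩
        α ^ e t * α ^ j                    ≈⟨ split t ⟨
        α ^ (e t + j)                      ∎)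

    OrderExactly : Set ℓ
    OrderExactly = ∀ k → 0 < k → k < N → ¬ (α ^ k ≈ 1#)

    small-power≈1⇒≡0 : OrderExactly → ∀ m → m < N → α ^ m ≈ 1# → m ≡ 0
    small-power≈1⇒≡0 minimal zero    _   _      = ≡.refl
    small-power≈1⇒≡0 minimal (suc m) m<N α^m≈1 = ⊥-elim (minimal (suc m) ℕ.z<s m<N α^m≈1)

    -- For α of order exactly N, α^d ≈ 1 only when N divides d: reduce d modulo N.
    α^d≈1⇒N∣d : OrderExactly → ∀ d → α ^ d ≈ 1# → N ∣ d
    α^d≈1⇒N∣d minimal d α^d≈1 =
      m%n≡0⇒n∣m d N (small-power≈1⇒≡0 minimal (d % N) (m%n<n d N) α^remainder≈1)
      where
      α^quotient≈1 : α ^ ((d / N) ℕ.* N) ≈ 1#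
      α^quotient≈1 = trans (^-congʳ α (ℕP.*-comm (d / N) N)) (α^[N*k]≈1 (d / N))
      α^remainder≈1 : α ^ (d % N) ≈ 1#
      α^remainder≈1 = begin
        α ^ (d % N)                        ≈⟨ *-identityʳ _ ⟨
        α ^ (d % N) * 1#                   ≈⟨ *-congˡ α^quotient≈1 ⟨
        α ^ (d % N) * α ^ ((d / N) ℕ.* N)  ≈⟨ ^-homo-* α (d % N) _ ⟨
        α ^ (d % N + (d / N) ℕ.* N)        ≈⟨ ^-congʳ α (≡.sym (m≡m%n+[m/n]*n d N)) ⟩
        α ^ d                              ≈⟨ α^d≈1 ⟩
        1#                                 ∎

    α^a≈α^b⇒a≡b : OrderExactly → ∀ a b → α ^ a ≈ α ^ b → a ≡[mod N ] b
    α^a≈α^b⇒a≡b minimal a b α^a≈α^b =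
      +-cancelˡ-≡[mod] k (multiples-congruent (k + a) (k + b) (α^d≈1⇒N∣d minimal (k + a) α^[k+a]≈1)
                                               (α^d≈1⇒N∣d minimal (k + b) α^[k+b]≈1))
      where
      -- multiply both sides by α^k, the inverse of α^b
      k = ℕ.pred N ℕ.* b
      α^[k+b]≈1 : α ^ (k + b) ≈ 1#
      α^[k+b]≈1 = trans (^-congʳ α (ℕP.+-comm k b)) (α^k-inverse b)
      α^[k+a]≈1 : α ^ (k + a) ≈ 1#
      α^[k+a]≈1 = begin
        α ^ (k + a)     ≈⟨ ^-homo-* α k a ⟩
        α ^ k * α ^ a   ≈⟨ *-congˡ α^a≈α^b ⟩
        α ^ k * α ^ b   ≈⟨ ^-homo-* α k b ⟨
        α ^ (k + b)     ≈⟨ α^[k+b]≈1 ⟩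
        1#              ∎

    module _ (i : Fin 7 → Fin N) where

      e : Fin 7 → ℕ
      e r = toℕ (i r)

      shiftSet-resp : ∀ {j x y} → x ≈ y → shiftSet α i j y → shiftSet α i j x
      shiftSet-resp x≈y (inj₁ y≈0)       = inj₁ (trans x≈y y≈0)
      shiftSet-resp x≈y (inj₂ (r , y≈r)) = inj₂ (r , trans x≈y y≈r)

      nonzero-point : ∀ {j x} → shiftSet α i j x → ¬ (x ≈ 0#) → ∃ λ r → x ≈ α ^ (e r + j)
      nonzero-point (inj₁ x≈0)  x≉0 = ⊥-elim (x≉0 x≈0)
      nonzero-point (inj₂ x≈αʳ) _   = x≈αʳ

      distinct-indices : ∀ {j a b r s} → a ≈ α ^ (e r + j) → b ≈ α ^ (e s + j) → ¬ (a ≈ b) → r ≢ s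
      distinct-indices a≈r b≈s a≉b ≡.refl = a≉b (trans a≈r (sym b≈s))

      span⊆shift : ∀ {j a b} → Is3DimSubspace α (λ r → e r + j) →
        shiftSet α i j a → shiftSet α i j b → Indep2 a b → ∀ x → span2 a b x → shiftSet α i j x
      span⊆shift _ _  _  _ x (inj₁ x≈0)               = inj₁ x≈0
      span⊆shift _ a∈ _  _ x (inj₂ (inj₁ x≈a))        = shiftSet-resp x≈a a∈
      span⊆shift _ _  b∈ _ x (inj₂ (inj₂ (inj₁ x≈b))) = shiftSet-resp x≈b b∈
      span⊆shift (_ , _ , closed) a∈ b∈ (a≉0 , b≉0 , a≉b) x (inj₂ (inj₂ (inj₂ x≈a+b)))
        with nonzero-point a∈ a≉0 | nonzero-point b∈ b≉0
      ... | p , a≈p | q , b≈q =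
        let (t , sum≈t) = closed p q (distinct-indices a≈p b≈q a≉b)
        in  inj₂ (t , trans x≈a+b (trans (+-cong a≈p b≈q) sum≈t))

      common-pair⇒same-shift : OrderExactly → DiffSetSize42 i → ∀ (j j' : Fin N) {a b} → Indep2 a b →
        shiftSet α i (toℕ j) a → shiftSet α i (toℕ j) b →
        shiftSet α i (toℕ j') a → shiftSet α i (toℕ j') b → j ≡ j'
      common-pair⇒same-shift minimal dif j j' (a≉0 , b≉0 , a≉b) a∈Φj b∈Φj a∈Φj' b∈Φj'
        with nonzero-point a∈Φj a≉0 | nonzero-point b∈Φj b≉0
           | nonzero-point a∈Φj' a≉0 | nonzero-point b∈Φj' b≉0
      ... | r , a≈r | s , b≈s | p , a≈p | q , b≈q = residue-injective j j' (+-cancelˡ-≡[mod] (e r) shifts≡)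
        where
        a-exponents : e r + toℕ j ≡[mod N ] e p + toℕ j'
        a-exponents = α^a≈α^b⇒a≡b minimal (e r + toℕ j) (e p + toℕ j') (trans (sym a≈r) a≈p)
        b-exponents : e s + toℕ j ≡[mod N ] e q + toℕ j'
        b-exponents = α^a≈α^b⇒a≡b minimal (e s + toℕ j) (e q + toℕ j') (trans (sym b≈s) b≈q)
        r≡p : r ≡ p
        r≡p = proj₁ (dif r s p q (distinct-indices a≈r b≈s a≉b) (distinct-indices a≈p b≈q a≉b)
                       (shifted-pairs⇒SameDiff (e r) (e s) (e p) (e q) a-exponents b-exponents))
        shifts≡ : e r + toℕ j ≡[mod N ] e r + toℕ j'
        shifts≡ = ≡.subst (λ t → e r + toℕ j ≡[mod N ] e t + toℕ j') (≡.sym r≡p) a-exponents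

      distinct-shifts : OrderExactly → DiffSetSize42 i → Is3DimSubspace α e →
        ∀ (j j' : Fin N) → j ≢ j' → ¬ (shiftSet α i (toℕ j) ≐ shiftSet α i (toℕ j'))
      distinct-shifts minimal dif X-subspace j j' j≢j' Φj≐Φj' =
        j≢j' (common-pair⇒same-shift minimal dif j j' independent a∈Φj b∈Φj (⊆Φj' _ a∈Φj) (⊆Φj' _ b∈Φj))
        where
        a = α ^ (e 0F + toℕ j)
        b = α ^ (e (sucF 0F) + toℕ j)
        a∈Φj : shiftSet α i (toℕ j) a
        a∈Φj = inj₂ (0F , refl)
        b∈Φj : shiftSet α i (toℕ j) b
        b∈Φj = inj₂ (sucF 0F , refl)
        independent : Indep2 a b
        independent = let (nonzero , distinct , _) = shift-subspace e (toℕ j) X-subspace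
                      in  nonzero 0F , nonzero (sucF 0F) , distinct 0F (sucF 0F) (λ ())
        ⊆Φj' : ∀ x → shiftSet α i (toℕ j) x → shiftSet α i (toℕ j') x
        ⊆Φj' x = proj₁ (Φj≐Φj' x)

      shared-plane⇒same-shift : OrderExactly → DiffSetSize42 i → Is3DimSubspace α e →
        ∀ (j j' : Fin N) {a b a' b'} →
        shiftSet α i (toℕ j) a → shiftSet α i (toℕ j) b → Indep2 a b →
        shiftSet α i (toℕ j') a' → shiftSet α i (toℕ j') b' → Indep2 a' b' →
        span2 a b ≐ span2 a' b' → j ≡ j'
      shared-plane⇒same-shift minimal dif X-subspace j j' {a} {b}
                              a∈Φj b∈Φj ab-indep a'∈Φj' b'∈Φj' a'b'-indep span≐ =
        common-pair⇒same-shift minimal dif j j' ab-indep a∈Φj b∈Φj (⊆Φj' _ a∈span) (⊆Φj' _ b∈span)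
        where
        ⊆Φj' : ∀ x → span2 a b x → shiftSet α i (toℕ j') x
        ⊆Φj' x x∈span = span⊆shift (shift-subspace e (toℕ j') X-subspace) a'∈Φj' b'∈Φj' a'b'-indep x
                           (proj₁ (span≐ x) x∈span)
        a∈span : span2 a b a
        a∈span = inj₂ (inj₁ refl)
        b∈span : span2 a b b
        b∈span = inj₂ (inj₂ (inj₁ refl))

mainTheorem5 : ∀ {c ℓ : Level} (R : CommutativeRing c ℓ) (n : ℕ) (α : CommutativeRing.Carrier R) →
    let open FieldDefs R in
    IsPrimitiveOfGF2 n α →
    (i : Fin 7 → Fin (ord n)) →
    Is3DimSubspace α (λ r → toℕ (i r)) →
    DiffSetSize42 i →
    ((j : Fin (ord n)) → Is3DimSubspace α (λ r → toℕ (i r) + toℕ j)) ×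
    ((j j' : Fin (ord n)) → j ≢ j' → ¬ (shiftSet α i (toℕ j) ≐ shiftSet α i (toℕ j'))) ×
    ((j j' : Fin (ord n)) (a b a' b' : CommutativeRing.Carrier R) →
      shiftSet α i (toℕ j) a → shiftSet α i (toℕ j) b → Indep2 a b →
      shiftSet α i (toℕ j') a' → shiftSet α i (toℕ j') b' → Indep2 a' b' →
      span2 a b ≐ span2 a' b' → j ≡ j')
mainTheorem5 R n α (_ , _ , α^N≈1 , minimal , _) i X-subspace dif =
    (λ j → shift-subspace (λ r → toℕ (i r)) (toℕ j) X-subspace)
  , distinct-shifts i minimal dif X-subspace
  , (λ j j' _ _ _ _ → shared-plane⇒same-shift i minimal dif X-subspace j j')
  where
  -- By primitivity α has order exactly N = 2^n - 1; N ≥ 1 as Fin N is inhabited.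
  instance
    N≢0 : NonZero (ord n)
    N≢0 = ℕ.>-nonZero (≤-<-trans ℕ.z≤n (toℕ<n (i 0F)))
  open Powers R α (ord n) α^N≈1
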